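{- Let $I\subset k[x_1,\dots,x_{d-1}]$ be a monomial ideal whose minimal generators have exponent vectors $\mathbf{a}_1,\dots,\mathbf{a}_n$, and suppose the points $(0,\mathbf{a}_1),\dots,(0,\mathbf{a}_n)\in\mathbb{TP}^{d-1}$ are in tropical general position. Then $I$ is a generic monomial ideal.
   Context: The points are in tropical general position if every square submatrix of the $d\times n$ real matrix with columns $(0,\mathbf{a}_1),\dots,(0,\mathbf{a}_n)$ is tropically non-singular, where a real $k\times k$ matrix $(a_{ij})$ is tropically non-singular if $\max_{\sigma\in S_k}\sum_i a_{i,\sigma(i)}$ is attained by a unique permutation. A monomial $m'$ strictly divides a monomial $m$ if $m'$ divides $m/x_i$ for every variable $x_i$ dividing $m$. A monomial ideal $I$ is generic (in the sense of Miller–Sturmfels) if whenever two distinct minimal generators $m,m'$ have the same positive degree in some variable, some third minimal generator strictly divides $\mathrm{lcm}(m,m')$. -}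

module Defs where

open import Data.Nat using (ℕ; zero; suc; _+_; _∸_; _≤_; _<_; _⊔_)
open import Data.Fin using (Fin; zero; suc; _≟_)
open import Data.Fin.Permutation using (Permutation′; _⟨$⟩ʳ_)
open import Data.Product using (Σ; _×_; ∃)
open import Relation.Binary.PropositionalEquality using (_≡_; _≢_)
open import Relation.Nullary using (¬_; yes; no)
open import Function.Definitions using (Injective)

Exp : ℕ → Set
Exp m = Fin m → ℕ

sumFin : ∀ {k} → (Fin k → ℕ) → ℕ
sumFin {zero}  f = 0
sumFin {suc k} f = f zero + sumFin (λ i → f (suc i))

Divides : ∀ {m} → Exp m → Exp m → Set
Divides b c = ∀ l → b l ≤ c l

lcmE : ∀ {m} → Exp m → Exp m → Exp m
lcmE b c l = b l ⊔ c l

-- c / x_i  (only used when x_i divides c).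
divVar : ∀ {m} → Exp m → Fin m → Exp m
divVar c i l with l ≟ i
... | yes _ = c l ∸ 1
... | no  _ = c l

StrictlyDivides : ∀ {m} → Exp m → Exp m → Set
StrictlyDivides b c = ∀ i → 1 ≤ c i → Divides b (divVar c i)

MinimalGenerators : ∀ {m n} → (Fin n → Exp m) → Set
MinimalGenerators {m} {n} a = Injective _≡_ _≡_ a × (∀ i j → i ≢ j → ¬ Divides (a i) (a j))

Generic : ∀ {m n} → (Fin n → Exp m) → Set
Generic {m} {n} a =
  ∀ i j → i ≢ j → ∀ (l : Fin m) → a i l ≡ a j l → 1 ≤ a i l →
  Σ (Fin n) λ k → k ≢ i × k ≢ j × StrictlyDivides (a k) (lcmE (a i) (a j))

TropNonSingular : ∀ {k} → (Fin k → Fin k → ℕ) → Set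
TropNonSingular {k} A =
  Σ (Permutation′ k) λ σ →
    ∀ (τ : Permutation′ k) → (∃ λ i → τ ⟨$⟩ʳ i ≢ σ ⟨$⟩ʳ i) →
      sumFin (λ i → A i (τ ⟨$⟩ʳ i)) < sumFin (λ i → A i (σ ⟨$⟩ʳ i))

pointMatrix : ∀ {m n} → (Fin n → Exp m) → Fin (suc m) → Fin n → ℕ
pointMatrix a zero    j = 0
pointMatrix a (suc l) j = a j l

TropGeneralPosition : ∀ {d n} → (Fin d → Fin n → ℕ) → Set
TropGeneralPosition {d} {n} M =
  ∀ (k : ℕ) (r : Fin k → Fin d) (c : Fin k → Fin n) →
    Injective _≡_ _≡_ r → Injective _≡_ _≡_ c →
    TropNonSingular (λ i j → M (r i) (c j))

-- The 2×2 submatrix of the point matrix on rows 0 and l and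
-- columns i, j is [[0, 0], [a_il, a_jl]]. If a_il = a_jl its two columns
-- agree, so both permutations attain the same sum and the submatrix is
-- tropically singular. Hence points in tropical general position never share
-- a coordinate, and the genericity condition holds vacuously.
module Submission where

open import Defs
open import Data.Nat using (ℕ; zero; suc; _+_)
open import Data.Nat.Properties using (<-irrefl)
open import Data.Fin using (Fin; zero; suc; _≟_)
open import Data.Fin.Permutation using (Permutation′; _⟨$⟩ʳ_; _⟨$⟩ˡ_; _∘ₚ_; transpose; inverseʳ)
import Data.Fin.Permutation.Components as PC
open import Data.Product using (_,_)
open import Data.Empty using (⊥-elim)
open import Function.Definitions using (Injective)
open import Relation.Binary.PropositionalEquality
open import Relation.Nullary using (¬_; yes; no)

sumFin-cong : ∀ {k} {f g : Fin k → ℕ} → (∀ i → f i ≡ g i) → sumFin f ≡ sumFin g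
sumFin-cong {zero} f≗g = refl
sumFin-cong {suc k}  f≗g = cong₂ _+_ (f≗g zero) (sumFin-cong (λ i → f≗g (suc i)))

transpose-respects : ∀ {k} {A : Set} (f : Fin k → A) {i j : Fin k} →
  f i ≡ f j → ∀ x → f (PC.transpose i j x) ≡ f x
transpose-respects f {i} {j} fi≡fj x with x ≟ i
... | yes refl = sym fi≡fj
... | no _ with x ≟ j
...   | yes refl = fi≡fj
...   | no _     = refl

transpose-moves : ∀ {k} {i j : Fin k} → i ≢ j → PC.transpose i j i ≢ i
transpose-moves {i = i} i≢j with i ≟ i
... | yes _   = λ j≡i → i≢j (sym j≡i)
... | no i≢i  = ⊥-elim (i≢i refl)

-- Composing the optimal permutation with the transposition of two equal
-- columns gives a different permutation with the same sum.
equalColumns⇒¬TropNonSingular : ∀ {k} (A : Fin k → Fin k → ℕ) {j j′ : Fin k} →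
  j ≢ j′ → (∀ i → A i j ≡ A i j′) → ¬ TropNonSingular A
equalColumns⇒¬TropNonSingular A {j} {j′} j≢j′ sameColumns (σ , σ-unique) =
  <-irrefl sameSum (σ-unique τ (σ ⟨$⟩ˡ j , τ-differs))
  where
  τ : Permutation′ _
  τ = σ ∘ₚ transpose j j′

  sameSum : sumFin (λ i → A i (τ ⟨$⟩ʳ i)) ≡ sumFin (λ i → A i (σ ⟨$⟩ʳ i))
  sameSum = sumFin-cong (λ i → transpose-respects (A i) (sameColumns i) (σ ⟨$⟩ʳ i))

  τ-differs : τ ⟨$⟩ʳ (σ ⟨$⟩ˡ j) ≢ σ ⟨$⟩ʳ (σ ⟨$⟩ˡ j)
  τ-differs rewrite inverseʳ σ {j} = transpose-moves j≢j′

pair : ∀ {k} → Fin k → Fin k → Fin 2 → Fin k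
pair x y zero       = x
pair x y (suc zero) = y

pair-injective : ∀ {k} {x y : Fin k} → x ≢ y → Injective _≡_ _≡_ (pair x y)
pair-injective x≢y {zero}     {zero}     _   = refl
pair-injective x≢y {zero}     {suc zero} x≡y = ⊥-elim (x≢y x≡y)
pair-injective x≢y {suc zero} {zero}     y≡x = ⊥-elim (x≢y (sym y≡x))
pair-injective x≢y {suc zero} {suc zero} _   = refl

tropGeneralPosition⇒distinctCoordinates : ∀ {m n} (a : Fin n → Exp m) →
  TropGeneralPosition (pointMatrix a) → ∀ {i j} → i ≢ j → ∀ l → a i l ≢ a j l
tropGeneralPosition⇒distinctCoordinates a tgp {i} {j} i≢j l ail≡ajl =
  equalColumns⇒¬TropNonSingular submatrix {zero} {suc zero} (λ ()) sameColumns
    (tgp 2 rows (pair i j) (pair-injective (λ ())) (pair-injective i≢j))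
  where
  rows : Fin 2 → Fin (suc _)
  rows = pair zero (suc l)

  submatrix : Fin 2 → Fin 2 → ℕ
  submatrix r c = pointMatrix a (rows r) (pair i j c)

  sameColumns : ∀ r → submatrix r zero ≡ submatrix r (suc zero)
  sameColumns zero       = refl
  sameColumns (suc zero) = ail≡ajl

mainTheorem11 : (m n : ℕ) (a : Fin n → Exp m) →
    MinimalGenerators a →
    TropGeneralPosition (pointMatrix a) →
    Generic a
mainTheorem11 m n a _ tgp i j i≢j l ail≡ajl _ =
  ⊥-elim (tropGeneralPosition⇒distinctCoordinates a tgp i≢j l ail≡ajl)
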